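{- Let $r$ and $m$ be positive integers, let $\varepsilon=\varepsilon_r(m)=((m-1)\bmod r)+1$ and $d=\lfloor (m-1)/r\rfloor$. Then $$\{m\}_r=\{\varepsilon\}_r\cdot\phi_r\Bigl(\Bigl\{\tfrac{m-\varepsilon}{r}+1\Bigr\}\Bigr)=s_1^{\varepsilon-1}\cdot\phi_r(\{d+1\})=s_1^{\varepsilon-1}\cdot\phi_r\Bigl(\Bigl\{\Bigl\lceil \tfrac{m}{r}\Bigr\rceil\Bigr\}\Bigr),$$ and $$\{m\}_r\{m-r\}_r\{m-2r\}_r\cdots\{\varepsilon\}_r=\prod_{j=0}^{d}\{m-jr\}_r=s_1^{(\varepsilon-1)(d+1)}\cdot\phi_r(\{d+1\}!)=s_1^{(\varepsilon-1)(d+1)}\cdot\phi_r\Bigl(\Bigl\{\Bigl\lceil \tfrac{m}{r}\Bigr\rceil\Bigr\}!\Bigr).$$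
   Context: Let $s_1,s_2,\dots$ be commuting indeterminates and $\mathbb{Z}[S]=\mathbb{Z}[s_1,s_2,\dots]$. The Lucas polynomials $\{m\}\in\mathbb{Z}[s_1,s_2]$ are defined by $\{0\}=0$, $\{1\}=1$, $\{m\}=s_1\{m-1\}+s_2\{m-2\}$ for $m\ge2$; $\{0\}!=1$ and $\{m\}!=\{m\}\cdot\{m-1\}!$. For a positive integer $r$, $\phi_r:\mathbb{Z}[s_1,s_2]\to\mathbb{Z}[S]$ is the ring homomorphism with $\phi_r(s_1)=s_r$, $\phi_r(s_2)=s_{2r}$. Here $m\bmod r\in\{0,\dots,r-1\}$ is the remainder. For $i\ge1$ let $\tau_i$ be a tile of length $i$; a tiling word of $k\ge0$ is a word $\tau_{i_1}\cdots\tau_{i_j}$ with $i_1+\cdots+i_j=k$ (the empty word for $k=0$), with weight $s_{i_1}\cdots s_{i_j}$. For $m\ge0$, $\Delta_{m,r}$ is the set of tiling words of $m$ consisting of $(m\bmod r)$ tiles $\tau_1$ followed by tiles from $\{\tau_r,\tau_{2r}\}$ in any order. The $r$-Lucas polynomials are $\{0\}_r=0$ and $\{m+1\}_r=\sum_{T\in\Delta_{m,r}}\mathrm{wt}(T)$ for $m\ge0$. -}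

module Defs where

open import Level using (Level)
open import Algebra.Bundles using (CommutativeRing)
open import Data.Nat as ℕ using (ℕ; zero; suc; _∸_; NonZero; _≡ᵇ_)
open import Data.Nat.DivMod using (_/_; _%_)
open import Data.Bool using (Bool; true; false; _∨_; _∧_)
open import Data.List using (List; []; _∷_; map; _++_; filterᵇ; foldr)

⌈_/_⌉ : (m r : ℕ) → .{{NonZero r}} → ℕ
⌈ m / r ⌉ = (m ℕ.+ (r ∸ 1)) / r

-- Tiling words: a word τ_{i1}⋯τ_{ij} is represented by the list [i1,…,ij] of tile lengths.
TilingWord : Set
TilingWord = List ℕ

-- All tiling words of k (compositions of k into positive parts), each exactly once.
bumpFirst : TilingWord → TilingWord
bumpFirst []      = []
bumpFirst (i ∷ w) = suc i ∷ w

tilings : ℕ → List TilingWord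
tilings zero          = [] ∷ []
tilings (suc zero)    = (1 ∷ []) ∷ []
tilings (suc (suc n)) = map (1 ∷_) (tilings (suc n)) ++ map bumpFirst (tilings (suc n))

allFromR2R : ℕ → TilingWord → Bool
allFromR2R r []      = true
allFromR2R r (i ∷ w) = ((i ≡ᵇ r) ∨ (i ≡ᵇ (2 ℕ.* r))) ∧ allFromR2R r w

onesThenR2R : ℕ → ℕ → TilingWord → Bool
onesThenR2R zero    r w              = allFromR2R r w
onesThenR2R (suc k) r (suc zero ∷ w) = onesThenR2R k r w
onesThenR2R (suc k) r _              = false

Δ : (m r : ℕ) → .{{NonZero r}} → List TilingWord
Δ m r = filterᵇ (onesThenR2R (m % r) r) (tilings m)

-- Polynomials in ℤ[S] are handled via evaluation in an arbitrary commutative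
-- ring R at an arbitrary assignment s : ℕ → R of the indeterminates s_i (s 0 unused).
module Poly {c ℓ : Level} (R : CommutativeRing c ℓ) (s : ℕ → CommutativeRing.Carrier R) where
  open CommutativeRing R

  pow : Carrier → ℕ → Carrier
  pow x zero    = 1#
  pow x (suc n) = x * pow x n

  wt : TilingWord → Carrier
  wt = foldr (λ i acc → s i * acc) 1#

  sumWt : List TilingWord → Carrier
  sumWt = foldr (λ w acc → wt w + acc) 0#

  rLucas : (r : ℕ) → .{{NonZero r}} → ℕ → Carrier
  rLucas r zero    = 0#
  rLucas r (suc m) = sumWt (Δ m r)

  -- Lucas polynomials {n} ∈ ℤ[s1,s2] evaluated at s1 := a, s2 := b
  lucas : Carrier → Carrier → ℕ → Carrier
  lucas a b zero          = 0#
  lucas a b (suc zero)    = 1#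
  lucas a b (suc (suc n)) = a * lucas a b (suc n) + b * lucas a b n

  lucasFact : Carrier → Carrier → ℕ → Carrier
  lucasFact a b zero    = 1#
  lucasFact a b (suc n) = lucas a b (suc n) * lucasFact a b n

  φLucas : ℕ → ℕ → Carrier
  φLucas r n = lucas (s r) (s (2 ℕ.* r)) n

  φLucasFact : ℕ → ℕ → Carrier
  φLucasFact r n = lucasFact (s r) (s (2 ℕ.* r)) n

  prodUpTo : ℕ → (ℕ → Carrier) → Carrier
  prodUpTo zero    f = f 0
  prodUpTo (suc d) f = prodUpTo d f * f (suc d)

module Submission where

-- Every word of Δ_{m-1,r} is ε-1 unit tiles followed by a tiling of m-ε = d r by the
-- tiles τ_r, τ_2r, so {m}_r = s_1^(ε-1) B(d r), where B(x) is the total weight of the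
-- {τ_r, τ_2r}-tilings of x. Splitting off the first tile gives B(0) = 1, B(r) = s_r and
-- B(x + 2r) = s_r B(x + r) + s_2r B(x): the Lucas recurrence under φ_r, so
-- B(d r) = φ_r({d+1}). The numbers m - j r for j ≤ d all have the same ε, which gives
-- the product formula.

open import Defs
open import Level using (Level)
open import Algebra.Bundles using (CommutativeRing)
open import Data.Nat as ℕ using (ℕ; suc; _∸_; NonZero)
open import Data.Nat.DivMod using (_/_; _%_)
open import Data.Product using (_×_)

import Algebra.Properties.CommutativeSemigroup as CommutativeSemigroupProperties
open import Data.Bool using (Bool; true; false; if_then_else_; _∨_)
open import Data.Empty using (⊥-elim)
open import Data.List using (List; []; _∷_; map; _++_; filterᵇ; foldr)
open import Data.Nat using (zero; _≡ᵇ_; _≤_; _<_; z≤n; s≤s)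
open import Data.Nat.DivMod
  using (m≡m%n+[m/n]*n; m%n<n; [m+kn]%n≡m%n; m<n⇒m%n≡m; m*n/n≡m; m/n≡1+[m∸n]/n; /-congˡ)
import Data.Nat.Properties as ℕₚ
open import Data.Nat.Tactic.RingSolver using (solve-∀)
open import Data.Product using (_,_)
open import Function using (_∘_)
import Relation.Binary.PropositionalEquality as ≡
open ≡ using (_≡_; _≢_)

rem-quot-elim : ∀ {p} (P : ℕ → ℕ → ℕ → Set p) r .{{_ : NonZero r}} →
                (∀ k q → k < r → P (k ℕ.+ q ℕ.* r) k q) → ∀ n → P n (n % r) (n / r)
rem-quot-elim P r split n =
  ≡.subst (λ m → P m (n % r) (n / r)) (≡.sym (m≡m%n+[m/n]*n n r)) (split (n % r) (n / r) (m%n<n n r))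

⌈suc/⌉≡suc[/] : ∀ n r .{{_ : NonZero r}} → ⌈ suc n / r ⌉ ≡ suc (n / r)
⌈suc/⌉≡suc[/] n r@(suc r') = begin
  suc (n ℕ.+ r') / r        ≡⟨ /-congˡ (≡.sym (ℕₚ.+-suc n r')) ⟩
  (n ℕ.+ r) / r             ≡⟨ m/n≡1+[m∸n]/n (ℕₚ.m≤n+m r n) ⟩
  suc ((n ℕ.+ r ∸ r) / r)   ≡⟨ ≡.cong (suc ∘ (_/ r)) (ℕₚ.m+n∸n≡m n r) ⟩
  suc (n / r)               ∎
  where open ≡.≡-Reasoning

[suc∸[%+1]]/≡/ : ∀ n r .{{_ : NonZero r}} → (suc n ∸ (n % r ℕ.+ 1)) / r ≡ n / r
[suc∸[%+1]]/≡/ n r = begin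
  (suc n ∸ (n % r ℕ.+ 1)) / r  ≡⟨ /-congˡ (≡.cong (suc n ∸_) (ℕₚ.+-comm (n % r) 1)) ⟩
  (n ∸ n % r) / r              ≡⟨ /-congˡ (≡.cong (_∸ n % r) (m≡m%n+[m/n]*n n r)) ⟩
  (n % r ℕ.+ n / r ℕ.* r ∸ n % r) / r ≡⟨ /-congˡ (ℕₚ.m+n∸m≡n (n % r) (n / r ℕ.* r)) ⟩
  n / r ℕ.* r / r              ≡⟨ m*n/n≡m (n / r) r ⟩
  n / r                        ∎
  where open ≡.≡-Reasoning

module TilingSums {c ℓ : Level} (R : CommutativeRing c ℓ) where
  open CommutativeRing R

  sumOver : {A : Set} → (A → Carrier) → List A → Carrier
  sumOver f = foldr (λ x acc → f x + acc) 0#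

  sumOver-++ : ∀ {A : Set} (f : A → Carrier) xs ys → sumOver f (xs ++ ys) ≈ sumOver f xs + sumOver f ys
  sumOver-++ f []       ys = sym (+-identityˡ _)
  sumOver-++ f (x ∷ xs) ys = trans (+-congˡ (sumOver-++ f xs ys)) (sym (+-assoc _ _ _))

  sumOver-map : ∀ {A B : Set} (f : B → Carrier) (g : A → B) xs →
                sumOver f (map g xs) ≡ sumOver (f ∘ g) xs
  sumOver-map f g []       = ≡.refl
  sumOver-map f g (x ∷ xs) = ≡.cong (f (g x) +_) (sumOver-map f g xs)

  sumOver-cong : ∀ {A : Set} {f g : A → Carrier} → (∀ x → f x ≈ g x) →
                 ∀ xs → sumOver f xs ≈ sumOver g xs
  sumOver-cong f≈g []       = refl
  sumOver-cong f≈g (x ∷ xs) = +-cong (f≈g x) (sumOver-cong f≈g xs)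

  sumOver-*ˡ : ∀ {A : Set} a (f : A → Carrier) xs → sumOver (λ x → a * f x) xs ≈ a * sumOver f xs
  sumOver-*ˡ a f []       = sym (zeroʳ a)
  sumOver-*ˡ a f (x ∷ xs) = trans (+-congˡ (sumOver-*ˡ a f xs)) (sym (distribˡ a _ _))

  sumOver-filterᵇ : ∀ {A : Set} (p : A → Bool) f xs →
                    sumOver f (filterᵇ p xs) ≈ sumOver (λ x → if p x then f x else 0#) xs
  sumOver-filterᵇ p f []       = refl
  sumOver-filterᵇ p f (x ∷ xs) with p x
  ... | true  = +-congˡ (sumOver-filterᵇ p f xs)
  ... | false = trans (sumOver-filterᵇ p f xs) (sym (+-identityˡ _))

  tilingSum : ℕ → (TilingWord → Carrier) → Carrier
  tilingSum n h = sumOver h (tilings n)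

  tilingSum-suc-suc : ∀ n h → tilingSum (suc (suc n)) h ≈
                      tilingSum (suc n) (h ∘ (1 ∷_)) + tilingSum (suc n) (h ∘ bumpFirst)
  tilingSum-suc-suc n h = trans (sumOver-++ h (map (1 ∷_) ts) (map bumpFirst ts))
    (+-cong (reflexive (sumOver-map h (1 ∷_) ts)) (reflexive (sumOver-map h bumpFirst ts)))
    where ts = tilings (suc n)

  -- leadingSum a g n = Σ_{t ≤ n} a (1 + t) · tilingSum (n - t) g: the tilings of n + 1
  -- weighted by a on their first tile and by g on the rest of the word.
  leadingSum : (ℕ → Carrier) → (TilingWord → Carrier) → ℕ → Carrier
  leadingSum a g zero    = a 1 * tilingSum 0 g
  leadingSum a g (suc n) = a 1 * tilingSum (suc n) g + leadingSum (a ∘ suc) g n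

  tilingSum-firstTile : ∀ {a g h} → (∀ i w → h (i ∷ w) ≈ a i * g w) →
                        ∀ n → tilingSum (suc n) h ≈ leadingSum a g n
  tilingSum-firstTile {a} {g} {h} h≈ zero    =
    trans (sumOver-cong (h≈ 1) (tilings 0)) (sumOver-*ˡ (a 1) g (tilings 0))
  tilingSum-firstTile {a} {g} {h} h≈ (suc n) = trans (tilingSum-suc-suc n h)
    (+-cong (trans (sumOver-cong (h≈ 1) ts) (sumOver-*ˡ (a 1) g ts))
            (tilingSum-firstTile {a ∘ suc} {g} {h ∘ bumpFirst} (h≈ ∘ suc) n))
    where ts = tilings (suc n)

  leadingSum-vanish : ∀ {a} g n → (∀ i → i ≤ n → a (suc i) ≈ 0#) → leadingSum a g n ≈ 0#
  leadingSum-vanish g zero    a≈0 = trans (*-congʳ (a≈0 0 z≤n)) (zeroˡ _)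
  leadingSum-vanish g (suc n) a≈0 =
    trans (+-cong (trans (*-congʳ (a≈0 0 z≤n)) (zeroˡ _))
                  (leadingSum-vanish g n (λ i → a≈0 (suc i) ∘ s≤s)))
          (+-identityˡ 0#)

  leadingSum-skip : ∀ {a} g t n → (∀ i → i < t → a (suc i) ≈ 0#) →
                    leadingSum a g (t ℕ.+ n) ≈ leadingSum (λ i → a (t ℕ.+ i)) g n
  leadingSum-skip g zero    n a≈0 = refl
  leadingSum-skip g (suc t) n a≈0 =
    trans (trans (+-congʳ (trans (*-congʳ (a≈0 0 (s≤s z≤n))) (zeroˡ _))) (+-identityˡ _))
          (leadingSum-skip g t n (λ i → a≈0 (suc i) ∘ s≤s))

  leadingSum-single : ∀ {a} g n → (∀ i → i < n → a (suc (suc i)) ≈ 0#) →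
                      leadingSum a g n ≈ a 1 * tilingSum n g
  leadingSum-single g zero    a≈0 = refl
  leadingSum-single g (suc n) a≈0 =
    trans (+-congˡ (leadingSum-vanish g n (λ i → a≈0 i ∘ s≤s))) (+-identityʳ _)

module PolyProperties {c ℓ : Level} (R : CommutativeRing c ℓ) (s : ℕ → CommutativeRing.Carrier R) where
  open CommutativeRing R
  open Poly R s

  pow-+ : ∀ x m n → pow x (m ℕ.+ n) ≈ pow x m * pow x n
  pow-+ x zero    n = sym (*-identityˡ _)
  pow-+ x (suc m) n = trans (*-congˡ (pow-+ x m n)) (sym (*-assoc _ _ _))

  prodUpTo-cong : ∀ d {f g : ℕ → Carrier} → (∀ j → f j ≈ g j) → prodUpTo d f ≈ prodUpTo d g
  prodUpTo-cong zero    f≈g = f≈g 0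
  prodUpTo-cong (suc d) f≈g = *-cong (prodUpTo-cong d f≈g) (f≈g (suc d))

  prodUpTo-suc : ∀ d f → prodUpTo (suc d) f ≈ f 0 * prodUpTo d (f ∘ suc)
  prodUpTo-suc zero    f = refl
  prodUpTo-suc (suc d) f = trans (*-congʳ (prodUpTo-suc d f)) (*-assoc _ _ _)

module RLucas {c ℓ : Level} (R : CommutativeRing c ℓ) (s : ℕ → CommutativeRing.Carrier R) (r' : ℕ) where
  open CommutativeRing R
  open Poly R s
  open TilingSums R
  open PolyProperties R s
  open CommutativeSemigroupProperties *-commutativeSemigroup using (interchange)
  open import Relation.Binary.Reasoning.Setoid setoid

  r : ℕ
  r = suc r'

  -- The summand of {n + 1}_r over the tilings of n when k = n mod r.
  restrictedWt : ℕ → TilingWord → Carrier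
  restrictedWt k w = if onesThenR2R k r w then wt w else 0#

  unitTileWt : ℕ → Carrier
  unitTileWt (suc zero) = s 1
  unitTileWt _          = 0#

  r2rTileWt : ℕ → Carrier
  r2rTileWt i = if (i ≡ᵇ r) ∨ (i ≡ᵇ 2 ℕ.* r) then s i else 0#

  r2rSum : ℕ → Carrier
  r2rSum n = tilingSum n (restrictedWt 0)

  restrictedWt-suc-∷ : ∀ k i w → restrictedWt (suc k) (i ∷ w) ≈ unitTileWt i * restrictedWt k w
  restrictedWt-suc-∷ k zero             w = sym (zeroˡ _)
  restrictedWt-suc-∷ k (suc (suc i))    w = sym (zeroˡ _)
  restrictedWt-suc-∷ k (suc zero)       w with onesThenR2R k r w
  ... | true  = refl
  ... | false = sym (zeroʳ _)

  restrictedWt-zero-∷ : ∀ i w → restrictedWt 0 (i ∷ w) ≈ r2rTileWt i * restrictedWt 0 w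
  restrictedWt-zero-∷ i w with (i ≡ᵇ r) ∨ (i ≡ᵇ 2 ℕ.* r) | allFromR2R r w
  ... | true  | true  = refl
  ... | true  | false = sym (zeroʳ _)
  ... | false | _     = sym (zeroˡ _)

  r2rTileWt-vanish : ∀ {x} → x ≢ r → x ≢ 2 ℕ.* r → r2rTileWt x ≈ 0#
  r2rTileWt-vanish {x} x≢r x≢2r with x ≡ᵇ r | ℕₚ.≡ᵇ⇒≡ x r | x ≡ᵇ 2 ℕ.* r | ℕₚ.≡ᵇ⇒≡ x (2 ℕ.* r)
  ... | true  | x≡r | _     | _    = ⊥-elim (x≢r (x≡r _))
  ... | false | _   | true  | x≡2r = ⊥-elim (x≢2r (x≡2r _))
  ... | false | _   | false | _    = refl

  r<2r : r < 2 ℕ.* r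
  r<2r = ℕₚ.m<m+n r (s≤s z≤n)

  r2rTileWt-below : ∀ {x} → x < r → r2rTileWt x ≈ 0#
  r2rTileWt-below x<r = r2rTileWt-vanish (ℕₚ.<⇒≢ x<r) (ℕₚ.<⇒≢ (ℕₚ.<-trans x<r r<2r))

  r2rTileWt-between : ∀ {y} → 0 < y → y < r → r2rTileWt (r ℕ.+ y) ≈ 0#
  r2rTileWt-between {y} 0<y y<r = r2rTileWt-vanish (ℕₚ.>⇒≢ (ℕₚ.m<m+n r 0<y)) (ℕₚ.<⇒≢ r+y<2r)
    where
    r+y<2r : r ℕ.+ y < 2 ℕ.* r
    r+y<2r = ≡.subst (r ℕ.+ y <_) (≡.cong (r ℕ.+_) (≡.sym (ℕₚ.+-identityʳ r))) (ℕₚ.+-monoʳ-< r y<r)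

  r2rTileWt-above : ∀ {y} → 0 < y → r2rTileWt (2 ℕ.* r ℕ.+ y) ≈ 0#
  r2rTileWt-above {y} 0<y = r2rTileWt-vanish (ℕₚ.>⇒≢ (ℕₚ.<-≤-trans r<2r (ℕₚ.m≤m+n _ y)))
                                             (ℕₚ.>⇒≢ (ℕₚ.m<m+n (2 ℕ.* r) 0<y))

  r2rTileWt-r : r2rTileWt r ≈ s r
  r2rTileWt-r with r ≡ᵇ r | ℕₚ.≡⇒≡ᵇ r r ≡.refl
  ... | true  | _  = refl
  ... | false | ()

  r2rTileWt-2r : r2rTileWt (2 ℕ.* r) ≈ s (2 ℕ.* r)
  r2rTileWt-2r with 2 ℕ.* r ≡ᵇ r | 2 ℕ.* r ≡ᵇ 2 ℕ.* r | ℕₚ.≡⇒≡ᵇ (2 ℕ.* r) (2 ℕ.* r) ≡.refl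
  ... | true  | _     | _  = refl
  ... | false | true  | _  = refl
  ... | false | false | ()

  tilingSum-restrictedWt : ∀ k n → tilingSum (k ℕ.+ n) (restrictedWt k) ≈ pow (s 1) k * r2rSum n
  tilingSum-restrictedWt zero    n = sym (*-identityˡ _)
  tilingSum-restrictedWt (suc k) n = begin
    tilingSum (suc (k ℕ.+ n)) (restrictedWt (suc k))
      ≈⟨ tilingSum-firstTile (restrictedWt-suc-∷ k) (k ℕ.+ n) ⟩
    leadingSum unitTileWt (restrictedWt k) (k ℕ.+ n)
      ≈⟨ leadingSum-single (restrictedWt k) (k ℕ.+ n) (λ _ _ → refl) ⟩
    s 1 * tilingSum (k ℕ.+ n) (restrictedWt k)
      ≈⟨ *-congˡ (tilingSum-restrictedWt k n) ⟩
    s 1 * (pow (s 1) k * r2rSum n)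
      ≈⟨ *-assoc _ _ _ ⟨
    pow (s 1) (suc k) * r2rSum n
      ∎

  r2rSum-skip : ∀ y → r2rSum (r ℕ.+ y) ≈ leadingSum (λ i → r2rTileWt (r' ℕ.+ i)) (restrictedWt 0) y
  r2rSum-skip y = trans (tilingSum-firstTile restrictedWt-zero-∷ (r' ℕ.+ y))
    (leadingSum-skip (restrictedWt 0) r' y (λ i i<r' → r2rTileWt-below (s≤s i<r')))

  r2rTileWt-r'+1 : r2rTileWt (r' ℕ.+ 1) ≈ s r
  r2rTileWt-r'+1 = trans (reflexive (≡.cong r2rTileWt (ℕₚ.+-comm r' 1))) r2rTileWt-r

  r2rSum-r : r2rSum (1 ℕ.* r) ≈ s r
  r2rSum-r = begin
    r2rSum (r ℕ.+ 0)                ≈⟨ r2rSum-skip 0 ⟩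
    r2rTileWt (r' ℕ.+ 1) * r2rSum 0 ≈⟨ *-cong r2rTileWt-r'+1 (+-identityʳ 1#) ⟩
    s r * 1#                        ≈⟨ *-identityʳ _ ⟩
    s r                             ∎

  r2rSum-recurrence : ∀ z → r2rSum (r ℕ.+ (r ℕ.+ z)) ≈ s r * r2rSum (r ℕ.+ z) + s (2 ℕ.* r) * r2rSum z
  r2rSum-recurrence z = begin
    r2rSum (r ℕ.+ (r ℕ.+ z))
      ≈⟨ r2rSum-skip (r ℕ.+ z) ⟩
    r2rTileWt (r' ℕ.+ 1) * r2rSum (r ℕ.+ z) + leadingSum (λ i → r2rTileWt (r' ℕ.+ suc i)) G (r' ℕ.+ z)
      ≈⟨ +-cong (*-congʳ r2rTileWt-r'+1) (leadingSum-skip G r' z between) ⟩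
    s r * r2rSum (r ℕ.+ z) + leadingSum (λ i → r2rTileWt (r' ℕ.+ suc (r' ℕ.+ i))) G z
      ≈⟨ +-congˡ (leadingSum-single G z (λ i _ → above i)) ⟩
    s r * r2rSum (r ℕ.+ z) + r2rTileWt (r' ℕ.+ suc (r' ℕ.+ 1)) * r2rSum z
      ≈⟨ +-congˡ (*-congʳ (trans (reflexive (≡.cong r2rTileWt (at2r r'))) r2rTileWt-2r)) ⟩
    s r * r2rSum (r ℕ.+ z) + s (2 ℕ.* r) * r2rSum z
      ∎
    where
    G : TilingWord → Carrier
    G = restrictedWt 0
    beyond2r : ∀ a i → a ℕ.+ suc (a ℕ.+ suc (suc i)) ≡ 2 ℕ.* suc a ℕ.+ suc i
    beyond2r = solve-∀
    at2r : ∀ a → a ℕ.+ suc (a ℕ.+ 1) ≡ 2 ℕ.* suc a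
    at2r = solve-∀
    between : ∀ i → i < r' → r2rTileWt (r' ℕ.+ suc (suc i)) ≈ 0#
    between i i<r' = trans (reflexive (≡.cong r2rTileWt (ℕₚ.+-suc r' (suc i))))
                           (r2rTileWt-between (s≤s z≤n) (s≤s i<r'))
    above : ∀ i → r2rTileWt (r' ℕ.+ suc (r' ℕ.+ suc (suc i))) ≈ 0#
    above i = trans (reflexive (≡.cong r2rTileWt (beyond2r r' i))) (r2rTileWt-above (s≤s z≤n))

  r2rSum-lucas : ∀ q → r2rSum (q ℕ.* r) ≈ φLucas r (suc q)
  r2rSum-lucas zero          = +-identityʳ 1#
  r2rSum-lucas (suc zero)    =
    trans r2rSum-r (sym (trans (+-cong (*-identityʳ _) (zeroʳ _)) (+-identityʳ _)))
  r2rSum-lucas (suc (suc q)) = trans (r2rSum-recurrence (q ℕ.* r))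
    (+-cong (*-congˡ (r2rSum-lucas (suc q))) (*-congˡ (r2rSum-lucas q)))

  rLucas-rem-quot : ∀ {k} q → k < r → rLucas r (suc (k ℕ.+ q ℕ.* r)) ≈ pow (s 1) k * φLucas r (suc q)
  rLucas-rem-quot {k} q k<r = begin
    rLucas r (suc n)                          ≈⟨ sumOver-filterᵇ (onesThenR2R (n % r) r) wt (tilings n) ⟩
    tilingSum n (restrictedWt (n % r))        ≡⟨ ≡.cong (tilingSum n ∘ restrictedWt) n%r≡k ⟩
    tilingSum (k ℕ.+ q ℕ.* r) (restrictedWt k) ≈⟨ tilingSum-restrictedWt k (q ℕ.* r) ⟩
    pow (s 1) k * r2rSum (q ℕ.* r)            ≈⟨ *-congˡ (r2rSum-lucas q) ⟩
    pow (s 1) k * φLucas r (suc q)            ∎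
    where
    n : ℕ
    n = k ℕ.+ q ℕ.* r
    n%r≡k : n % r ≡ k
    n%r≡k = ≡.trans ([m+kn]%n≡m%n k q r) (m<n⇒m%n≡m k<r)

  rLucas-below : ∀ {k} → k < r → rLucas r (k ℕ.+ 1) ≈ pow (s 1) k
  rLucas-below {k} k<r = trans (reflexive (≡.cong (rLucas r) (ℕₚ.+-suc k 0)))
                               (trans (rLucas-rem-quot 0 k<r) (*-identityʳ _))

  prodUpTo-rLucas-rem-quot : ∀ {k} q → k < r →
    prodUpTo q (λ j → rLucas r (suc (k ℕ.+ q ℕ.* r) ∸ j ℕ.* r)) ≈
    pow (s 1) (k ℕ.* suc q) * φLucasFact r (suc q)
  prodUpTo-rLucas-rem-quot {k} zero    k<r = trans (rLucas-rem-quot 0 k<r)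
    (sym (*-cong (reflexive (≡.cong (pow (s 1)) (ℕₚ.*-identityʳ k))) (*-identityˡ 1#)))
  prodUpTo-rLucas-rem-quot {k} (suc q) k<r = begin
    prodUpTo (suc q) f
      ≈⟨ prodUpTo-suc q f ⟩
    f 0 * prodUpTo q (f ∘ suc)
      ≈⟨ *-cong (rLucas-rem-quot (suc q) k<r)
                (trans (prodUpTo-cong q (λ j → reflexive (≡.cong (rLucas r) (∸-shift j))))
                       (prodUpTo-rLucas-rem-quot q k<r)) ⟩
    (pow (s 1) k * φLucas r (suc (suc q))) * (pow (s 1) (k ℕ.* suc q) * φLucasFact r (suc q))
      ≈⟨ interchange _ _ _ _ ⟩
    (pow (s 1) k * pow (s 1) (k ℕ.* suc q)) * φLucasFact r (suc (suc q))
      ≈⟨ *-congʳ (pow-+ (s 1) k (k ℕ.* suc q)) ⟨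
    pow (s 1) (k ℕ.+ k ℕ.* suc q) * φLucasFact r (suc (suc q))
      ≡⟨ ≡.cong (λ e → pow (s 1) e * φLucasFact r (suc (suc q))) (ℕₚ.*-suc k (suc q)) ⟨
    pow (s 1) (k ℕ.* suc (suc q)) * φLucasFact r (suc (suc q))
      ∎
    where
    f : ℕ → Carrier
    f j = rLucas r (suc (k ℕ.+ suc q ℕ.* r) ∸ j ℕ.* r)
    rearrange : ∀ k a x → suc (k ℕ.+ (suc a ℕ.+ x)) ≡ suc a ℕ.+ suc (k ℕ.+ x)
    rearrange = solve-∀
    ∸-shift : ∀ j → suc (k ℕ.+ suc q ℕ.* r) ∸ suc j ℕ.* r ≡ suc (k ℕ.+ q ℕ.* r) ∸ j ℕ.* r
    ∸-shift j = ≡.trans (≡.cong (_∸ suc j ℕ.* r) (rearrange k r' (q ℕ.* r)))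
                        (ℕₚ.[m+n]∸[m+o]≡n∸o r (suc (k ℕ.+ q ℕ.* r)) (j ℕ.* r))

  rLucas-suc : ∀ n → rLucas r (suc n) ≈ pow (s 1) (n % r) * φLucas r (suc (n / r))
  rLucas-suc = rem-quot-elim (λ n k q → rLucas r (suc n) ≈ pow (s 1) k * φLucas r (suc q)) r
                             (λ k q → rLucas-rem-quot q)

  prodUpTo-rLucas-suc : ∀ n → prodUpTo (n / r) (λ j → rLucas r (suc n ∸ j ℕ.* r)) ≈
                              pow (s 1) (n % r ℕ.* suc (n / r)) * φLucasFact r (suc (n / r))
  prodUpTo-rLucas-suc = rem-quot-elim
    (λ n k q → prodUpTo q (λ j → rLucas r (suc n ∸ j ℕ.* r)) ≈
               pow (s 1) (k ℕ.* suc q) * φLucasFact r (suc q))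
    r (λ k q → prodUpTo-rLucas-rem-quot q)

lemma4p2 : {c ℓ : Level} (R : CommutativeRing c ℓ) (s : ℕ → CommutativeRing.Carrier R)
    (r m : ℕ) .{{_ : NonZero r}} → NonZero m →
    let open CommutativeRing R
        open Poly R s
        ε = ℕ._+_ ((m ∸ 1) % r) 1
        d = (m ∸ 1) / r
    in (rLucas r m ≈ rLucas r ε * φLucas r (ℕ._+_ ((m ∸ ε) / r) 1))
       × (rLucas r m ≈ pow (s 1) (ε ∸ 1) * φLucas r (ℕ._+_ d 1))
       × (rLucas r m ≈ pow (s 1) (ε ∸ 1) * φLucas r ⌈ m / r ⌉)
       × (prodUpTo d (λ j → rLucas r (m ∸ ℕ._*_ j r)) ≈ pow (s 1) (ℕ._*_ (ε ∸ 1) (ℕ._+_ d 1)) * φLucasFact r (ℕ._+_ d 1))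
       × (prodUpTo d (λ j → rLucas r (m ∸ ℕ._*_ j r)) ≈ pow (s 1) (ℕ._*_ (ε ∸ 1) (ℕ._+_ d 1)) * φLucasFact r ⌈ m / r ⌉)
lemma4p2 R s zero     _       _ = ⊥-elim (ℕ.≢-nonZero⁻¹ 0 ≡.refl)
lemma4p2 R s (suc r') zero    ()
lemma4p2 R s (suc r') (suc n) _
  rewrite [suc∸[%+1]]/≡/ n (suc r') ⦃ _ ⦄ | ⌈suc/⌉≡suc[/] n (suc r') ⦃ _ ⦄
        | ℕₚ.m+n∸n≡m (n % suc r') 1 | ℕₚ.+-comm (n / suc r') 1
  = trans (rLucas-suc n) (*-congʳ (sym (rLucas-below (m%n<n n (suc r')))))
  , rLucas-suc n , rLucas-suc n , prodUpTo-rLucas-suc n , prodUpTo-rLucas-suc n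
  where
  open CommutativeRing R using (trans; sym; *-congʳ)
  open RLucas R s r'
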